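{- Let $M$ be a matroid with ground set $\mathcal{A}$, $a\in\mathcal{A}$, and $k$ a positive integer. (1) If $a$ is a loop, then $T^k_M(x_1,\dots,x_k;y_1,\dots,y_k)=T^k_L(x_1,\dots,x_k;y_1,\dots,y_k)\,T^k_{M\backslash a}(x_1,\dots,x_k;y_1,\dots,y_k)$, where $L$ is the matroid consisting of a single loop. (2) If $a$ is a coloop, then $T^k_M(x_1,\dots,x_k;y_1,\dots,y_k)=T^k_C(x_1,\dots,x_k;y_1,\dots,y_k)\,T^k_{M/a}(x_1,\dots,x_k;y_1,\dots,y_k)$, where $C$ is the matroid consisting of a single coloop.
   Context: For a matroid $N$ on ground set $E$ with rank function $\mathrm{rk}_N$, $T^k_N((x_i)_1^k;(y_i)_1^k)=\sum_{S_1\subseteq\cdots\subseteq S_k\subseteq E}\prod_{i=1}^k(x_i-1)^{\mathrm{rk}_N(E)-\mathrm{rk}_N(S_i)}(y_i-1)^{|S_i|-\mathrm{rk}_N(S_i)}$ (sum over weakly increasing chains of $k$ subsets). A loop is an element of rank $0$; a coloop is an element $a$ with $\mathrm{rk}(\mathcal{A}-a)=\mathrm{rk}(\mathcal{A})-1$. $M\backslash a$ is the deletion (ground set $\mathcal{A}-a$, rank function restricted) and $M/a$ the contraction (ground set $\mathcal{A}-a$, $\mathrm{rk}_{M/a}(X)=\mathrm{rk}(X\cup a)-\mathrm{rk}(a)$). $L$ has one element of rank $0$; $C$ has one element of rank $1$. -}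

module Defs where

open import Level using (Level)
open import Data.Bool using (Bool; true; false; _∧_)
open import Data.Nat using (ℕ; zero; suc; _+_; _∸_; _≤_)
open import Data.Fin using (Fin; zero; suc)
open import Data.Fin.Subset using (Subset; inside; outside; _⊆_; _∪_; _∩_; ⊤; ⁅_⁆; ∁; ∣_∣)
open import Data.Fin.Subset.Properties using (_⊆?_)
open import Data.Vec using (Vec; []; _∷_; insertAt)
open import Data.List using (List; []; _∷_; map; _++_; filterᵇ; concatMap; foldr)
open import Relation.Nullary using (does)
open import Relation.Binary.PropositionalEquality using (_≡_)
open import Algebra.Bundles using (CommutativeRing)

record Matroid (n : ℕ) : Set where
  field
    rk        : Subset n → ℕ
    rk-bound  : ∀ X → rk X ≤ ∣ X ∣
    rk-mono   : ∀ {X Y} → X ⊆ Y → rk X ≤ rk Y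
    rk-submod : ∀ X Y → rk (X ∪ Y) + rk (X ∩ Y) ≤ rk X + rk Y
open Matroid public

IsLoop : ∀ {n} → Matroid n → Fin n → Set
IsLoop M a = rk M ⁅ a ⁆ ≡ 0

-- a is a coloop:  rk (E - a) = rk E - 1, written as rk (E - a) + 1 = rk E
IsColoop : ∀ {n} → Matroid n → Fin n → Set
IsColoop M a = rk M (∁ ⁅ a ⁆) + 1 ≡ rk M ⊤

-- Deletion M \ a : ground set E - a (identified with Fin n via insertion at a),
-- rank function restricted.
deletionRk : ∀ {n} → Matroid (suc n) → Fin (suc n) → Subset n → ℕ
deletionRk M a X = rk M (insertAt X a outside)

contractionRk : ∀ {n} → Matroid (suc n) → Fin (suc n) → Subset n → ℕ
contractionRk M a X = rk M (insertAt X a inside) ∸ rk M ⁅ a ⁆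

loopRk : Subset 1 → ℕ
loopRk _ = 0

coloopRk : Subset 1 → ℕ
coloopRk X = ∣ X ∣

allSubsets : (n : ℕ) → List (Subset n)
allSubsets zero    = [] ∷ []
allSubsets (suc n) = map (outside ∷_) (allSubsets n) ++ map (inside ∷_) (allSubsets n)

allTuples : (n k : ℕ) → List (Vec (Subset n) k)
allTuples n zero    = [] ∷ []
allTuples n (suc k) = concatMap (λ S → map (S ∷_) (allTuples n k)) (allSubsets n)

isChain : ∀ {n k} → Vec (Subset n) k → Bool
isChain []              = true
isChain (S ∷ [])        = true
isChain (S ∷ T ∷ rest)  = does (S ⊆? T) ∧ isChain (T ∷ rest)

chains : (n k : ℕ) → List (Vec (Subset n) k)
chains n k = filterᵇ isChain (allTuples n k)

module _ {c ℓ : Level} (R : CommutativeRing c ℓ) where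
  open CommutativeRing R using (Carrier; 0#; 1#) renaming (_+_ to _+R_; _*_ to _*R_; _-_ to _-R_)

  pow : Carrier → ℕ → Carrier
  pow x zero    = 1#
  pow x (suc m) = x *R pow x m

  chainTerm : ∀ {n k} → (Subset n → ℕ) → Vec Carrier k → Vec Carrier k
            → Vec (Subset n) k → Carrier
  chainTerm rkf []       []       []       = 1#
  chainTerm rkf (x ∷ xs) (y ∷ ys) (S ∷ Ss) =
    (pow (x -R 1#) (rkf ⊤ ∸ rkf S) *R pow (y -R 1#) (∣ S ∣ ∸ rkf S))
      *R chainTerm rkf xs ys Ss

  Tk : (n k : ℕ) → (Subset n → ℕ) → Vec Carrier k → Vec Carrier k → Carrier
  Tk n k rkf xs ys = foldr (λ Ss acc → chainTerm rkf xs ys Ss +R acc) 0# (chains n k)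

-- Adding a loop a to a set never changes its rank and adding a coloop always raises
-- it by one, so in both cases the rank of X ∪ A, for A ⊆ {a}, is the rank of A in L
-- (resp. C) plus the rank of X in M \ a (resp. M / a): M is a direct sum. Corank and
-- nullity are additive over a direct sum, so every chain term of T^k factorises, and a
-- chain S₁ ⊆ ⋯ ⊆ S_k in the ground set is the same as a chain in {a} together with a
-- chain in the rest; summing the factorised terms over all such pairs gives the product.
module Submission where

open import Defs
open import Level using (Level)
open import Algebra.Bundles using (CommutativeRing; CommutativeMonoid)
import Algebra.Properties.CommutativeSemigroup as CommutativeSemigroupProperties
open import Data.Bool using (Bool; true; false; _∧_; _∨_; not; if_then_else_)
open import Data.Bool.Properties using (∧-zeroʳ; ∨-idem; ∧-commutativeMonoid)
open import Data.Fin using (Fin; zero; suc)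
open import Data.Fin.Subset using (Subset; inside; outside; _∪_; _∩_; ⊤; ⊥; ⁅_⁆; ∁; ∣_∣)
open import Data.Fin.Subset.Properties
  using (_⊆?_; p⊆p∪q; ∪-identityʳ; ∪-zeroʳ; ∩-identityʳ; ∣p∣≤n; ∣⊥∣≡0; ∣⁅x⁆∣≡1)
open import Data.List using (List; []; _∷_; map; _++_; filterᵇ; concatMap; foldr)
open import Data.Nat using (ℕ; zero; suc; _∸_; _≤_; z≤n)
import Data.Nat.Properties as ℕ
open import Data.Product using (_×_; _,_)
open import Data.Vec using (Vec; []; _∷_; insertAt; replicate; zipWith)
open import Data.Vec.Properties using (map-insertAt; map-replicate)
open import Relation.Nullary using (does)
open import Relation.Binary.PropositionalEquality
  using (_≡_; refl; sym; trans; cong; cong₂; subst; module ≡-Reasoning)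

private
  variable
    A : Set
    m : ℕ

zipWith-insertAt : (f : A → A → A) (xs ys : Vec A m) (i : Fin (suc m)) (x y : A) →
                   zipWith f (insertAt xs i x) (insertAt ys i y) ≡ insertAt (zipWith f xs ys) i (f x y)
zipWith-insertAt f xs       ys       zero    x y = refl
zipWith-insertAt f (u ∷ xs) (v ∷ ys) (suc i) x y = cong (f u v ∷_) (zipWith-insertAt f xs ys i x y)

insertAt-replicate : ∀ m (i : Fin (suc m)) (x : A) → insertAt (replicate m x) i x ≡ replicate (suc m) x
insertAt-replicate m       zero    x = refl
insertAt-replicate (suc m) (suc i) x = cong (x ∷_) (insertAt-replicate m i x)

⁅⁆≡insertAt-⊥ : (i : Fin (suc m)) → ⁅ i ⁆ ≡ insertAt ⊥ i inside
⁅⁆≡insertAt-⊥ zero            = refl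
⁅⁆≡insertAt-⊥ {suc m} (suc i) = cong (outside ∷_) (⁅⁆≡insertAt-⊥ i)

∁⁅⁆≡insertAt-⊤ : (i : Fin (suc m)) → ∁ ⁅ i ⁆ ≡ insertAt ⊤ i outside
∁⁅⁆≡insertAt-⊤ {m} i = begin
  ∁ ⁅ i ⁆                   ≡⟨ cong ∁ (⁅⁆≡insertAt-⊥ i) ⟩
  ∁ (insertAt ⊥ i inside)   ≡⟨ map-insertAt not inside ⊥ i ⟩
  insertAt (∁ ⊥) i outside  ≡⟨ cong (λ Z → insertAt Z i outside) (map-replicate not outside m) ⟩
  insertAt ⊤ i outside      ∎
  where open ≡-Reasoning

insertAt-outside-∪-⁅⁆ : (X : Subset m) (i : Fin (suc m)) → insertAt X i outside ∪ ⁅ i ⁆ ≡ insertAt X i inside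
insertAt-outside-∪-⁅⁆ X i = begin
  insertAt X i outside ∪ ⁅ i ⁆               ≡⟨ cong (insertAt X i outside ∪_) (⁅⁆≡insertAt-⊥ i) ⟩
  insertAt X i outside ∪ insertAt ⊥ i inside  ≡⟨ zipWith-insertAt _∨_ X ⊥ i outside inside ⟩
  insertAt (X ∪ ⊥) i inside                   ≡⟨ cong (λ Z → insertAt Z i inside) (∪-identityʳ X) ⟩
  insertAt X i inside                         ∎
  where open ≡-Reasoning

insertAt-inside-∪-∁⁅⁆ : (X : Subset m) (i : Fin (suc m)) → insertAt X i inside ∪ ∁ ⁅ i ⁆ ≡ ⊤
insertAt-inside-∪-∁⁅⁆ {m} X i = begin
  insertAt X i inside ∪ ∁ ⁅ i ⁆               ≡⟨ cong (insertAt X i inside ∪_) (∁⁅⁆≡insertAt-⊤ i) ⟩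
  insertAt X i inside ∪ insertAt ⊤ i outside  ≡⟨ zipWith-insertAt _∨_ X ⊤ i inside outside ⟩
  insertAt (X ∪ ⊤) i inside                   ≡⟨ cong (λ Z → insertAt Z i inside) (∪-zeroʳ X) ⟩
  insertAt ⊤ i inside                         ≡⟨ insertAt-replicate m i inside ⟩
  ⊤                                           ∎
  where open ≡-Reasoning

insertAt-inside-∩-∁⁅⁆ : (X : Subset m) (i : Fin (suc m)) → insertAt X i inside ∩ ∁ ⁅ i ⁆ ≡ insertAt X i outside
insertAt-inside-∩-∁⁅⁆ X i = begin
  insertAt X i inside ∩ ∁ ⁅ i ⁆               ≡⟨ cong (insertAt X i inside ∩_) (∁⁅⁆≡insertAt-⊤ i) ⟩
  insertAt X i inside ∩ insertAt ⊤ i outside  ≡⟨ zipWith-insertAt _∧_ X ⊤ i inside outside ⟩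
  insertAt (X ∩ ⊤) i outside                  ≡⟨ cong (λ Z → insertAt Z i outside) (∩-identityʳ X) ⟩
  insertAt X i outside                        ∎
  where open ≡-Reasoning

does-insertAt-⊆? : (X Y : Subset m) (i : Fin (suc m)) (v w : Bool) →
                   does (insertAt X i v ⊆? insertAt Y i w) ≡ does (v ∷ [] ⊆? w ∷ []) ∧ does (X ⊆? Y)
does-insertAt-⊆? X             Y             zero    outside w       = refl
does-insertAt-⊆? X             Y             zero    inside  outside = refl
does-insertAt-⊆? X             Y             zero    inside  inside  = refl
does-insertAt-⊆? (outside ∷ X) (y ∷ Y)       (suc i) v       w       = does-insertAt-⊆? X Y i v w
does-insertAt-⊆? (inside ∷ X)  (outside ∷ Y) (suc i) v       w       = sym (∧-zeroʳ _)
does-insertAt-⊆? (inside ∷ X)  (inside ∷ Y)  (suc i) v       w       = does-insertAt-⊆? X Y i v w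

-- Chains in Fin (suc n) as pairs of chains in Fin 1 and Fin n

joinAt : ∀ {k} → Fin (suc m) → Vec (Subset 1) k → Vec (Subset m) k → Vec (Subset (suc m)) k
joinAt i []               []      = []
joinAt i ((v ∷ []) ∷ Bs) (X ∷ Xs) = insertAt X i v ∷ joinAt i Bs Xs

isChain-joinAt : ∀ {k} (i : Fin (suc m)) (Bs : Vec (Subset 1) k) (Xs : Vec (Subset m) k) →
                 isChain (joinAt i Bs Xs) ≡ isChain Bs ∧ isChain Xs
isChain-joinAt i []                             []           = refl
isChain-joinAt i ((v ∷ []) ∷ [])                (X ∷ [])     = refl
isChain-joinAt i ((v ∷ []) ∷ (w ∷ []) ∷ Bs) (X ∷ Y ∷ Xs) =
  trans (cong₂ _∧_ (does-insertAt-⊆? X Y i v w) (isChain-joinAt i ((w ∷ []) ∷ Bs) (Y ∷ Xs)))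
        (∧-interchange (does (v ∷ [] ⊆? w ∷ [])) (does (X ⊆? Y))
                       (isChain ((w ∷ []) ∷ Bs)) (isChain (Y ∷ Xs)))
  where
  open CommutativeSemigroupProperties (CommutativeMonoid.commutativeSemigroup ∧-commutativeMonoid)
    renaming (interchange to ∧-interchange)

module Sums {c ℓ : Level} (R : CommutativeRing c ℓ) where
  open CommutativeRing R renaming (refl to ≈-refl; sym to ≈-sym; trans to ≈-trans)
  open import Relation.Binary.Reasoning.Setoid setoid
  open CommutativeSemigroupProperties +-commutativeSemigroup renaming (interchange to +-interchange)

  -- Chosen so that Tk R n k r xs ys is definitionally ∑ (chains n k) (chainTerm R r xs ys).
  ∑ : {B : Set} → List B → (B → Carrier) → Carrier
  ∑ xs f = foldr (λ x acc → f x + acc) 0# xs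

  syntax ∑ xs (λ x → e) = ∑[ x ∈ xs ] e

  ∑-cong : {B : Set} (xs : List B) {f g : B → Carrier} → (∀ x → f x ≈ g x) → ∑ xs f ≈ ∑ xs g
  ∑-cong []       f≈g = ≈-refl
  ∑-cong (x ∷ xs) f≈g = +-cong (f≈g x) (∑-cong xs f≈g)

  ∑-++ : {B : Set} (xs ys : List B) (f : B → Carrier) → ∑ (xs ++ ys) f ≈ ∑ xs f + ∑ ys f
  ∑-++ []       ys f = ≈-sym (+-identityˡ _)
  ∑-++ (x ∷ xs) ys f = ≈-trans (+-congˡ (∑-++ xs ys f)) (≈-sym (+-assoc _ _ _))

  ∑-map : {B C : Set} (h : B → C) (xs : List B) (f : C → Carrier) → ∑ (map h xs) f ≈ ∑ xs (λ x → f (h x))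
  ∑-map h []       f = ≈-refl
  ∑-map h (x ∷ xs) f = +-congˡ (∑-map h xs f)

  ∑-concatMap : {B C : Set} (g : B → List C) (xs : List B) (f : C → Carrier) →
                ∑ (concatMap g xs) f ≈ ∑[ x ∈ xs ] ∑ (g x) f
  ∑-concatMap g []       f = ≈-refl
  ∑-concatMap g (x ∷ xs) f = ≈-trans (∑-++ (g x) _ f) (+-congˡ (∑-concatMap g xs f))

  ∑-zero : {B : Set} (xs : List B) → ∑[ x ∈ xs ] 0# ≈ 0#
  ∑-zero []       = ≈-refl
  ∑-zero (x ∷ xs) = ≈-trans (+-identityˡ _) (∑-zero xs)

  ∑-distrib-+ : {B : Set} (xs : List B) (f g : B → Carrier) → ∑[ x ∈ xs ] (f x + g x) ≈ ∑ xs f + ∑ xs g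
  ∑-distrib-+ []       f g = ≈-sym (+-identityˡ _)
  ∑-distrib-+ (x ∷ xs) f g = ≈-trans (+-congˡ (∑-distrib-+ xs f g)) (+-interchange _ _ _ _)

  ∑-comm : {B C : Set} (xs : List B) (ys : List C) (f : B → C → Carrier) →
           ∑[ x ∈ xs ] ∑[ y ∈ ys ] f x y ≈ ∑[ y ∈ ys ] ∑[ x ∈ xs ] f x y
  ∑-comm []       ys f = ≈-sym (∑-zero ys)
  ∑-comm (x ∷ xs) ys f = ≈-trans (+-congˡ (∑-comm xs ys f)) (≈-sym (∑-distrib-+ ys (f x) _))

  ∑-distribˡ : {B : Set} (xs : List B) (u : Carrier) (f : B → Carrier) → u * ∑ xs f ≈ ∑[ x ∈ xs ] (u * f x)
  ∑-distribˡ []       u f = zeroʳ u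
  ∑-distribˡ (x ∷ xs) u f = ≈-trans (distribˡ u _ _) (+-congˡ (∑-distribˡ xs u f))

  ∑-distribʳ : {B : Set} (xs : List B) (u : Carrier) (f : B → Carrier) → ∑ xs f * u ≈ ∑[ x ∈ xs ] (f x * u)
  ∑-distribʳ []       u f = zeroˡ u
  ∑-distribʳ (x ∷ xs) u f = ≈-trans (distribʳ u _ _) (+-congˡ (∑-distribʳ xs u f))

  ∑-filterᵇ : {B : Set} (p : B → Bool) (xs : List B) (f : B → Carrier) →
              ∑ (filterᵇ p xs) f ≈ ∑[ x ∈ xs ] (if p x then f x else 0#)
  ∑-filterᵇ p []       f = ≈-refl
  ∑-filterᵇ p (x ∷ xs) f with p x
  ... | true  = +-congˡ (∑-filterᵇ p xs f)
  ... | false = ≈-trans (∑-filterᵇ p xs f) (≈-sym (+-identityˡ _))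

  if-cong : ∀ b {u v} → u ≈ v → (if b then u else 0#) ≈ (if b then v else 0#)
  if-cong true  u≈v = u≈v
  if-cong false u≈v = ≈-refl

  if-∧ : ∀ p q u v → (if p ∧ q then u * v else 0#) ≈ (if p then u else 0#) * (if q then v else 0#)
  if-∧ true  true  u v = ≈-refl
  if-∧ true  false u v = ≈-sym (zeroʳ u)
  if-∧ false q     u v = ≈-sym (zeroˡ _)

  ∑-allSubsets-suc : ∀ n (g : Subset (suc n) → Carrier) →
    ∑ (allSubsets (suc n)) g ≈
      ∑[ X ∈ allSubsets n ] g (outside ∷ X) + ∑[ X ∈ allSubsets n ] g (inside ∷ X)
  ∑-allSubsets-suc n g =
    ≈-trans (∑-++ (map (outside ∷_) (allSubsets n)) _ g)
            (+-cong (∑-map _ (allSubsets n) g) (∑-map _ (allSubsets n) g))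

  ∑-allSubsets-insertAt : ∀ n (i : Fin (suc n)) (g : Subset (suc n) → Carrier) →
    ∑ (allSubsets (suc n)) g ≈
      ∑[ X ∈ allSubsets n ] g (insertAt X i outside) + ∑[ X ∈ allSubsets n ] g (insertAt X i inside)
  ∑-allSubsets-insertAt n       zero    g = ∑-allSubsets-suc n g
  ∑-allSubsets-insertAt (suc n) (suc i) g = begin
    ∑ (allSubsets (suc (suc n))) g
      ≈⟨ ∑-allSubsets-suc (suc n) g ⟩
    ∑[ S ∈ allSubsets (suc n) ] g (outside ∷ S) + ∑[ S ∈ allSubsets (suc n) ] g (inside ∷ S)
      ≈⟨ +-cong (∑-allSubsets-insertAt n i _) (∑-allSubsets-insertAt n i _) ⟩
    (h outside outside + h outside inside) + (h inside outside + h inside inside)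
      ≈⟨ +-interchange _ _ _ _ ⟩
    (h outside outside + h inside outside) + (h outside inside + h inside inside)
      ≈⟨ ≈-sym (+-cong (∑-allSubsets-suc n _) (∑-allSubsets-suc n _)) ⟩
    ∑[ X ∈ allSubsets (suc n) ] g (insertAt X (suc i) outside)
      + ∑[ X ∈ allSubsets (suc n) ] g (insertAt X (suc i) inside)
      ∎
    where
    h : Bool → Bool → Carrier
    h x v = ∑[ X ∈ allSubsets n ] g (x ∷ insertAt X i v)

  ∑-allTuples-suc : ∀ n k (F : Vec (Subset n) (suc k) → Carrier) →
    ∑ (allTuples n (suc k)) F ≈ ∑[ S ∈ allSubsets n ] ∑[ Ss ∈ allTuples n k ] F (S ∷ Ss)
  ∑-allTuples-suc n k F =
    ≈-trans (∑-concatMap (λ S → map (S ∷_) (allTuples n k)) (allSubsets n) F)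
          (∑-cong (allSubsets n) (λ S → ∑-map (S ∷_) (allTuples n k) F))

  ∑-allTuples-joinAt : ∀ n (i : Fin (suc n)) k (F : Vec (Subset (suc n)) k → Carrier) →
    ∑ (allTuples (suc n) k) F ≈ ∑[ Bs ∈ allTuples 1 k ] ∑[ Xs ∈ allTuples n k ] F (joinAt i Bs Xs)
  ∑-allTuples-joinAt n i zero    F = ≈-sym (+-identityʳ _)
  ∑-allTuples-joinAt n i (suc k) F = begin
    ∑ (allTuples (suc n) (suc k)) F
      ≈⟨ ∑-allTuples-suc (suc n) k F ⟩
    ∑[ S ∈ allSubsets (suc n) ] ∑[ Ss ∈ allTuples (suc n) k ] F (S ∷ Ss)
      ≈⟨ ∑-cong (allSubsets (suc n)) (λ S → ∑-allTuples-joinAt n i k (λ Ss → F (S ∷ Ss))) ⟩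
    ∑[ S ∈ allSubsets (suc n) ] ∑[ Bs ∈ allTuples 1 k ] ∑[ Xs ∈ allTuples n k ] F (S ∷ joinAt i Bs Xs)
      ≈⟨ ∑-allSubsets-insertAt n i _ ⟩
    G outside + G inside
      ≈⟨ +-cong (≈-sym (H≈G outside)) (≈-trans (≈-sym (H≈G inside)) (≈-sym (+-identityʳ _))) ⟩
    H outside + (H inside + 0#)
      ≈⟨ ≈-sym (∑-allTuples-suc 1 k _) ⟩
    ∑[ Bs ∈ allTuples 1 (suc k) ] ∑[ Xs ∈ allTuples n (suc k) ] F (joinAt i Bs Xs)
      ∎
    where
    G : Bool → Carrier
    G v = ∑[ X ∈ allSubsets n ] ∑[ Bs ∈ allTuples 1 k ] ∑[ Xs ∈ allTuples n k ]
            F (insertAt X i v ∷ joinAt i Bs Xs)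
    H : Bool → Carrier
    H v = ∑[ Bs ∈ allTuples 1 k ] ∑[ Xs ∈ allTuples n (suc k) ] F (joinAt i ((v ∷ []) ∷ Bs) Xs)
    H≈G : ∀ v → H v ≈ G v
    H≈G v = ≈-trans (∑-cong (allTuples 1 k) (λ Bs → ∑-allTuples-suc n k _))
                    (∑-comm (allTuples 1 k) (allSubsets n) _)

-- ℕ addition is opened only after the ring sums, whose _+_ it would clash with.
open import Data.Nat using (_+_)

-- Direct sums of rank functions

∣insertAt∣ : (X : Subset m) (i : Fin (suc m)) (v : Bool) → ∣ insertAt X i v ∣ ≡ ∣ v ∷ [] ∣ + ∣ X ∣
∣insertAt∣ X             zero    outside = refl
∣insertAt∣ X             zero    inside  = refl
∣insertAt∣ (outside ∷ X) (suc i) v       = ∣insertAt∣ X i v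
∣insertAt∣ (inside ∷ X)  (suc i) v       =
  trans (cong suc (∣insertAt∣ X i v)) (sym (ℕ.+-suc ∣ v ∷ [] ∣ ∣ X ∣))

corank : (Subset m → ℕ) → Subset m → ℕ
corank r S = r ⊤ ∸ r S

nullity : (Subset m → ℕ) → Subset m → ℕ
nullity r S = ∣ S ∣ ∸ r S

record SplitsAt (i : Fin (suc m)) (f : Subset (suc m) → ℕ) (f₁ : Subset 1 → ℕ) (f₂ : Subset m → ℕ) : Set where
  field
    split : ∀ v X → f (insertAt X i v) ≡ f₁ (v ∷ []) + f₂ X
open SplitsAt

record IsBoundedRank (r : Subset m → ℕ) : Set where
  field
    ≤-size : ∀ X → r X ≤ ∣ X ∣
    ≤-top  : ∀ X → r X ≤ r ⊤
open IsBoundedRank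

[m+n]∸[o+p]≡[m∸o]+[n∸p] : ∀ {m n o p} → o ≤ m → p ≤ n → (m + n) ∸ (o + p) ≡ (m ∸ o) + (n ∸ p)
[m+n]∸[o+p]≡[m∸o]+[n∸p] {m} {n} {o} {p} o≤m p≤n = begin
  (m + n) ∸ (o + p)   ≡⟨ sym (ℕ.∸-+-assoc (m + n) o p) ⟩
  (m + n) ∸ o ∸ p     ≡⟨ cong (_∸ p) (ℕ.+-∸-comm n o≤m) ⟩
  (m ∸ o + n) ∸ p     ≡⟨ ℕ.+-∸-assoc (m ∸ o) p≤n ⟩
  m ∸ o + (n ∸ p)     ∎
  where open ≡-Reasoning

module _ {i : Fin (suc m)} {r : Subset (suc m) → ℕ} {r₁ : Subset 1 → ℕ} {r₂ : Subset m → ℕ}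
         (directSum : SplitsAt i r r₁ r₂) (bounded₁ : IsBoundedRank r₁) (bounded₂ : IsBoundedRank r₂)
         where

  corank-directSum : SplitsAt i (corank r) (corank r₁) (corank r₂)
  split corank-directSum v X =
    trans (cong₂ _∸_ r⊤ (split directSum v X))
          ([m+n]∸[o+p]≡[m∸o]+[n∸p] (≤-top bounded₁ _) (≤-top bounded₂ X))
    where
    r⊤ : r ⊤ ≡ r₁ ⊤ + r₂ ⊤
    r⊤ = trans (cong r (sym (insertAt-replicate m i inside))) (split directSum inside ⊤)

  nullity-directSum : SplitsAt i (nullity r) (nullity r₁) (nullity r₂)
  split nullity-directSum v X =
    trans (cong₂ _∸_ (∣insertAt∣ X i v) (split directSum v X))
          ([m+n]∸[o+p]≡[m∸o]+[n∸p] (≤-size bounded₁ _) (≤-size bounded₂ X))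

module _ {c ℓ : Level} (R : CommutativeRing c ℓ) {n : ℕ} (i : Fin (suc n))
         {r : Subset (suc n) → ℕ} {r₁ : Subset 1 → ℕ} {r₂ : Subset n → ℕ} where
  open CommutativeRing R hiding (_+_) renaming (refl to ≈-refl; sym to ≈-sym; trans to ≈-trans)
  open Sums R
  open import Relation.Binary.Reasoning.Setoid setoid
  open CommutativeSemigroupProperties *-commutativeSemigroup renaming (interchange to *-interchange)

  pow-+ : ∀ x m n → pow R x (m + n) ≈ pow R x m * pow R x n
  pow-+ x zero    n = ≈-sym (*-identityˡ _)
  pow-+ x (suc m) n = ≈-trans (*-congˡ (pow-+ x m n)) (≈-sym (*-assoc _ _ _))

  chainTerm-joinAt :
    SplitsAt i (corank r) (corank r₁) (corank r₂) → SplitsAt i (nullity r) (nullity r₁) (nullity r₂) →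
    ∀ {k} (xs ys : Vec Carrier k) Bs Xs →
    chainTerm R r xs ys (joinAt i Bs Xs) ≈ chainTerm R r₁ xs ys Bs * chainTerm R r₂ xs ys Xs
  chainTerm-joinAt corank-split nullity-split []       []       []               []       = ≈-sym (*-identityˡ _)
  chainTerm-joinAt corank-split nullity-split (x ∷ xs) (y ∷ ys) ((v ∷ []) ∷ Bs) (X ∷ Xs) =
    ≈-trans (*-cong head-factor (chainTerm-joinAt corank-split nullity-split xs ys Bs Xs)) (*-interchange _ _ _ _)
    where
    factor : ∀ z {e} e₁ e₂ → e ≡ e₁ + e₂ → pow R z e ≈ pow R z e₁ * pow R z e₂
    factor z e₁ e₂ e≡ = ≈-trans (reflexive (cong (pow R z) e≡)) (pow-+ z e₁ e₂)
    head-factor =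
      ≈-trans (*-cong (factor (x - 1#) _ (corank r₂ X) (split corank-split v X))
                      (factor (y - 1#) _ (nullity r₂ X) (split nullity-split v X)))
              (*-interchange _ _ _ _)

  Tk-joinAt :
    SplitsAt i (corank r) (corank r₁) (corank r₂) → SplitsAt i (nullity r) (nullity r₁) (nullity r₂) →
    ∀ k (xs ys : Vec Carrier k) → Tk R (suc n) k r xs ys ≈ Tk R 1 k r₁ xs ys * Tk R n k r₂ xs ys
  Tk-joinAt corank-split nullity-split k xs ys = begin
    Tk R (suc n) k r xs ys
      ≈⟨ ∑-filterᵇ isChain (allTuples (suc n) k) _ ⟩
    ∑ (allTuples (suc n) k) (term r)
      ≈⟨ ∑-allTuples-joinAt n i k (term r) ⟩
    ∑[ Bs ∈ allTuples 1 k ] ∑[ Xs ∈ allTuples n k ] term r (joinAt i Bs Xs)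
      ≈⟨ ∑-cong (allTuples 1 k) (λ Bs → ∑-cong (allTuples n k) (term-joinAt Bs)) ⟩
    ∑[ Bs ∈ allTuples 1 k ] ∑[ Xs ∈ allTuples n k ] (term r₁ Bs * term r₂ Xs)
      ≈⟨ ∑-cong (allTuples 1 k) (λ Bs → ≈-sym (∑-distribˡ (allTuples n k) (term r₁ Bs) (term r₂))) ⟩
    ∑[ Bs ∈ allTuples 1 k ] (term r₁ Bs * ∑ (allTuples n k) (term r₂))
      ≈⟨ ≈-sym (∑-distribʳ (allTuples 1 k) _ (term r₁)) ⟩
    ∑ (allTuples 1 k) (term r₁) * ∑ (allTuples n k) (term r₂)
      ≈⟨ ≈-sym (*-cong (∑-filterᵇ isChain (allTuples 1 k) _) (∑-filterᵇ isChain (allTuples n k) _)) ⟩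
    Tk R 1 k r₁ xs ys * Tk R n k r₂ xs ys
      ∎
    where
    term : ∀ {m} → (Subset m → ℕ) → Vec (Subset m) k → Carrier
    term ρ Ss = if isChain Ss then chainTerm R ρ xs ys Ss else 0#
    term-joinAt : ∀ Bs Xs → term r (joinAt i Bs Xs) ≈ term r₁ Bs * term r₂ Xs
    term-joinAt Bs Xs = begin
      term r (joinAt i Bs Xs)
        ≡⟨ cong (λ b → if b then chainTerm R r xs ys (joinAt i Bs Xs) else 0#) (isChain-joinAt i Bs Xs) ⟩
      (if isChain Bs ∧ isChain Xs then chainTerm R r xs ys (joinAt i Bs Xs) else 0#)
        ≈⟨ if-cong (isChain Bs ∧ isChain Xs) (chainTerm-joinAt corank-split nullity-split xs ys Bs Xs) ⟩
      (if isChain Bs ∧ isChain Xs then chainTerm R r₁ xs ys Bs * chainTerm R r₂ xs ys Xs else 0#)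
        ≈⟨ if-∧ (isChain Bs) (isChain Xs) _ _ ⟩
      term r₁ Bs * term r₂ Xs
        ∎

  Tk-directSum : SplitsAt i r r₁ r₂ → IsBoundedRank r₁ → IsBoundedRank r₂ →
    ∀ k (xs ys : Vec Carrier k) → Tk R (suc n) k r xs ys ≈ Tk R 1 k r₁ xs ys * Tk R n k r₂ xs ys
  Tk-directSum directSum bounded₁ bounded₂ =
    Tk-joinAt (corank-directSum directSum bounded₁ bounded₂) (nullity-directSum directSum bounded₁ bounded₂)

-- A loop or a coloop splits off as a direct summand

loopRk-bounded : IsBoundedRank loopRk
≤-size loopRk-bounded _ = z≤n
≤-top  loopRk-bounded _ = z≤n

coloopRk-bounded : IsBoundedRank coloopRk
≤-size coloopRk-bounded _ = ℕ.≤-refl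
≤-top  coloopRk-bounded X = ∣p∣≤n X

rk-≤-∪ : (M : Matroid m) (X Y : Subset m) → rk M X ≤ rk M (X ∪ Y)
rk-≤-∪ M X Y = rk-mono M (p⊆p∪q Y)

rk-⊥ : (M : Matroid m) → rk M ⊥ ≡ 0
rk-⊥ {m} M = ℕ.n≤0⇒n≡0 (ℕ.≤-trans (rk-bound M ⊥) (ℕ.≤-reflexive (∣⊥∣≡0 m)))

rk-⁅⁆≤1 : (M : Matroid m) (a : Fin m) → rk M ⁅ a ⁆ ≤ 1
rk-⁅⁆≤1 M a = ℕ.≤-trans (rk-bound M ⁅ a ⁆) (ℕ.≤-reflexive (∣⁅x⁆∣≡1 a))

module _ (M : Matroid (suc m)) (a : Fin (suc m)) where
  open ℕ.≤-Reasoning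

  private
    rk⁺ : Subset m → ℕ
    rk⁺ X = rk M (insertAt X a inside)

  rk-insertAt-≤-⊤ : ∀ v X → rk M (insertAt X a v) ≤ rk M (insertAt ⊤ a v)
  rk-insertAt-≤-⊤ v X = subst (rk M (insertAt X a v) ≤_) (cong (rk M) ∪-⊤) (rk-≤-∪ M _ _)
    where
    ∪-⊤ : insertAt X a v ∪ insertAt ⊤ a v ≡ insertAt ⊤ a v
    ∪-⊤ = trans (zipWith-insertAt _∨_ X ⊤ a v v) (cong₂ (λ Z u → insertAt Z a u) (∪-zeroʳ X) (∨-idem v))

  deletionRk≤rk⁺ : ∀ X → deletionRk M a X ≤ rk⁺ X
  deletionRk≤rk⁺ X = subst (deletionRk M a X ≤_) (cong (rk M) (insertAt-outside-∪-⁅⁆ X a)) (rk-≤-∪ M _ ⁅ a ⁆)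

  rk⁺≤deletionRk+rk⁅⁆ : ∀ X → rk⁺ X ≤ deletionRk M a X + rk M ⁅ a ⁆
  rk⁺≤deletionRk+rk⁅⁆ X = begin
    rk⁺ X                                  ≡⟨ cong (rk M) (sym (insertAt-outside-∪-⁅⁆ X a)) ⟩
    rk M (Y ∪ ⁅ a ⁆)                       ≤⟨ ℕ.m≤m+n _ _ ⟩
    rk M (Y ∪ ⁅ a ⁆) + rk M (Y ∩ ⁅ a ⁆)    ≤⟨ rk-submod M Y ⁅ a ⁆ ⟩
    deletionRk M a X + rk M ⁅ a ⁆          ∎
    where Y = insertAt X a outside

  deletionRk-bounded : IsBoundedRank (deletionRk M a)
  ≤-size deletionRk-bounded X = ℕ.≤-trans (rk-bound M _) (ℕ.≤-reflexive (∣insertAt∣ X a outside))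
  ≤-top  deletionRk-bounded X = rk-insertAt-≤-⊤ outside X

  contractionRk-bounded : IsBoundedRank (contractionRk M a)
  ≤-size contractionRk-bounded X = ℕ.≤-trans contractionRk≤deletionRk (≤-size deletionRk-bounded X)
    where
    contractionRk≤deletionRk : contractionRk M a X ≤ deletionRk M a X
    contractionRk≤deletionRk = ℕ.m≤n+o⇒m∸n≤o _ (rk M ⁅ a ⁆)
      (ℕ.≤-trans (rk⁺≤deletionRk+rk⁅⁆ X) (ℕ.≤-reflexive (ℕ.+-comm _ (rk M ⁅ a ⁆))))
  ≤-top  contractionRk-bounded X = ℕ.∸-monoˡ-≤ (rk M ⁅ a ⁆) (rk-insertAt-≤-⊤ inside X)

  rk⁺-loop : IsLoop M a → ∀ X → rk⁺ X ≡ deletionRk M a X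
  rk⁺-loop loop X = ℕ.≤-antisym (begin
    rk⁺ X                           ≤⟨ rk⁺≤deletionRk+rk⁅⁆ X ⟩
    deletionRk M a X + rk M ⁅ a ⁆   ≡⟨ cong (deletionRk M a X +_) loop ⟩
    deletionRk M a X + 0            ≡⟨ ℕ.+-identityʳ _ ⟩
    deletionRk M a X                ∎) (deletionRk≤rk⁺ X)

  loop-splits : IsLoop M a → SplitsAt a (rk M) loopRk (deletionRk M a)
  split (loop-splits loop) outside X = refl
  split (loop-splits loop) inside  X = rk⁺-loop loop X

  module _ (coloop : IsColoop M a) where

    rk⁺-coloop : ∀ X → rk⁺ X ≡ suc (deletionRk M a X)
    rk⁺-coloop X = ℕ.≤-antisym upper lower
      where
      Q = ∁ ⁅ a ⁆
      upper : rk⁺ X ≤ suc (deletionRk M a X)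
      upper = begin
        rk⁺ X                          ≤⟨ rk⁺≤deletionRk+rk⁅⁆ X ⟩
        deletionRk M a X + rk M ⁅ a ⁆  ≤⟨ ℕ.+-monoʳ-≤ _ (rk-⁅⁆≤1 M a) ⟩
        deletionRk M a X + 1           ≡⟨ ℕ.+-comm _ 1 ⟩
        suc (deletionRk M a X)         ∎
      lower : suc (deletionRk M a X) ≤ rk⁺ X
      lower = ℕ.+-cancelˡ-≤ (rk M Q) _ _ (begin
        rk M Q + suc (deletionRk M a X)  ≡⟨ sym (ℕ.+-assoc (rk M Q) 1 _) ⟩
        rk M Q + 1 + deletionRk M a X    ≡⟨ cong (_+ deletionRk M a X) coloop ⟩
        rk M ⊤ + deletionRk M a X        ≡⟨ sym (cong₂ (λ S T → rk M S + rk M T) ∪-Q ∩-Q) ⟩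
        rk M (Y ∪ Q) + rk M (Y ∩ Q)      ≤⟨ rk-submod M Y Q ⟩
        rk⁺ X + rk M Q                   ≡⟨ ℕ.+-comm (rk⁺ X) _ ⟩
        rk M Q + rk⁺ X                   ∎)
        where
        Y = insertAt X a inside
        ∪-Q = insertAt-inside-∪-∁⁅⁆ X a
        ∩-Q = insertAt-inside-∩-∁⁅⁆ X a

    rk-⁅⁆-coloop : rk M ⁅ a ⁆ ≡ 1
    rk-⁅⁆-coloop = begin-equality
      rk M ⁅ a ⁆                         ≡⟨ cong (rk M) (⁅⁆≡insertAt-⊥ a) ⟩
      rk⁺ ⊥                              ≡⟨ rk⁺-coloop ⊥ ⟩
      suc (rk M (insertAt ⊥ a outside))  ≡⟨ cong (λ Z → suc (rk M Z)) (insertAt-replicate m a outside) ⟩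
      suc (rk M ⊥)                       ≡⟨ cong suc (rk-⊥ M) ⟩
      1                                  ∎

    contractionRk≡deletionRk : ∀ X → contractionRk M a X ≡ deletionRk M a X
    contractionRk≡deletionRk X = cong₂ _∸_ (rk⁺-coloop X) rk-⁅⁆-coloop

    coloop-splits : SplitsAt a (rk M) coloopRk (contractionRk M a)
    split coloop-splits outside X = sym (contractionRk≡deletionRk X)
    split coloop-splits inside  X = trans (rk⁺-coloop X) (cong suc (sym (contractionRk≡deletionRk X)))

proposition3p12 : ∀ {c ℓ : Level} (R : CommutativeRing c ℓ) (n : ℕ)
    (M : Matroid (suc n)) (a : Fin (suc n)) (k : ℕ) → 1 ≤ k →
    (xs ys : Vec (CommutativeRing.Carrier R) k) →
    (IsLoop M a →
      CommutativeRing._≈_ R (Tk R (suc n) k (rk M) xs ys)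
        (CommutativeRing._*_ R (Tk R 1 k loopRk xs ys) (Tk R n k (deletionRk M a) xs ys)))
    × (IsColoop M a →
      CommutativeRing._≈_ R (Tk R (suc n) k (rk M) xs ys)
        (CommutativeRing._*_ R (Tk R 1 k coloopRk xs ys) (Tk R n k (contractionRk M a) xs ys)))
proposition3p12 R n M a k _ xs ys =
  (λ loop → Tk-directSum R a (loop-splits M a loop) loopRk-bounded (deletionRk-bounded M a) k xs ys) ,
  (λ coloop → Tk-directSum R a (coloop-splits M a coloop) coloopRk-bounded (contractionRk-bounded M a) k xs ys)
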